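{- For every $b\in B_n$, the partition $\alpha(b)$ of the $2n$ boundary points is noncrossing and has no singleton blocks; that is, $\alpha(b)\in P_{2n}$.
   Context: An $n$th-order chromatic diagram is a plane graph (loops and multiple edges allowed), up to isotopy, inside a rectangle with $n$ marked boundary points on the top side and $n$ on the bottom side, the graph lying in the interior except for attachment to boundary points, each boundary point having valency $1$. Inner vertices are non-boundary vertices; inner edges are edges with both endpoints inner. $B_n$ denotes the set of $n$th-order chromatic diagrams with no inner edges and all of whose inner vertices have valency at least $3$. Number the boundary points $1,\dots,2n$ counterclockwise starting at the bottom-left (bottom points $1,\dots,n$ left to right, then top points $n+1,\dots,2n$ right to left), and regard them as $2n$ points placed in this order on a circle. For $b\in B_n$, $\alpha(b)$ is the partition of $\{1,\dots,2n\}$ whose blocks are the sets of boundary points lying in a common connected component of $b$. A partition of points on a circle is noncrossing if, joining the points of each block cyclically by chords, no two chords from different blocks intersect. $P_{2n}$ is the set of noncrossing partitions of the $2n$ points with no singleton blocks. -}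

module Defs where

open import Data.Nat using (ℕ; zero; suc; _+_; _*_; _<_; _≤_)
open import Data.Fin using (Fin; zero; suc; toℕ)
open import Data.Bool using (Bool; true; false; not)
open import Data.Product using (Σ; ∃; ∃-syntax; _×_; _,_)
open import Data.Sum using (_⊎_)
open import Data.Empty using (⊥)
open import Data.Unit using (⊤)
open import Relation.Binary.PropositionalEquality using (_≡_; _≢_)
open import Relation.Nullary using (¬_)

iter : {A : Set} → (A → A) → ℕ → A → A
iter f zero    x = x
iter f (suc k) x = f (iter f k x)

cycSucc : ∀ {k} → Fin (suc k) → Fin (suc k)
cycSucc {zero}  zero    = zero
cycSucc {suc k} zero    = suc zero
cycSucc {suc k} (suc i) with cycSucc {k} i
... | zero  = zero
... | suc j = suc (suc j)

-- Noncrossing partitions of the points 0,…,N-1 placed in this order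
-- (counterclockwise) on a circle.  A partition is given by its
-- "same block" relation R.

-- z lies strictly inside the counterclockwise arc from x to y
Between : ∀ {N} → Fin N → Fin N → Fin N → Set
Between x y z =
  (toℕ x < toℕ z × toℕ z < toℕ y) ⊎
  (toℕ y ≤ toℕ x × (toℕ x < toℕ z ⊎ toℕ z < toℕ y))

-- x,y are cyclically consecutive elements of one block (going
-- counterclockwise from x); these are the chords obtained by joining
-- the points of each block cyclically.
Chord : ∀ {N} → (Fin N → Fin N → Set) → Fin N → Fin N → Set
Chord R x y = R x y × x ≢ y × (∀ z → R x z → ¬ Between x y z)

NonCrossing : ∀ {N} → (Fin N → Fin N → Set) → Set
NonCrossing R = ∀ x y u v → Chord R x y → Chord R u v → ¬ R x u →
  ¬ ((Between x y u × Between y x v) ⊎ (Between x y v × Between y x u))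

NoSingletons : ∀ {N} → (Fin N → Fin N → Set) → Set
NoSingletons R = ∀ i → ∃[ j ] (j ≢ i × R i j)

InP : ∀ {N} → (Fin N → Fin N → Set) → Set
InP R = NonCrossing R × NoSingletons R

-- A diagram b of order n is encoded by the plane graph G' = b ∪ ∂,
-- where ∂ is the boundary of the rectangle, viewed as a cycle through
-- the vertices  corner, point 1, …, point 2n  (in counterclockwise
-- order; "corner" is one extra degree-2 vertex between point 2n and
-- point 1).  The embedding in the plane is encoded as a rotation system
-- (combinatorial map); planarity is the Euler condition V + F = E + 2
-- (G' is connected for diagrams in B_n), and "b lies inside the
-- rectangle" is the condition that some face consists only of
-- boundary-cycle darts (the outside face).

data Vertex (n m : ℕ) : Set where
  corner : Vertex n m
  bd     : Fin (2 * n) → Vertex n m   -- bd i = boundary point i+1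
  inner  : Fin m → Vertex n m

IsInner : ∀ {n m} → Vertex n m → Set
IsInner (inner _) = ⊤
IsInner corner    = ⊥
IsInner (bd _)    = ⊥

-- vertex k of the boundary cycle (0 = corner, k+1 = point k+1)
cycV : ∀ {n m} → Fin (suc (2 * n)) → Vertex n m
cycV zero    = corner
cycV (suc i) = bd i

-- darts: cyc k false = dart of cycle edge k at vertex k (pointing to k+1),
--        cyc k true  = dart of cycle edge k at vertex k+1;
--        gr j b      = end b of edge j of the diagram
data Dart (n e : ℕ) : Set where
  cyc : Fin (suc (2 * n)) → Bool → Dart n e
  gr  : Fin e → Bool → Dart n e

IsCyc : ∀ {n e} → Dart n e → Set
IsCyc (cyc _ _) = ⊤
IsCyc (gr _ _)  = ⊥

record RawDiagram (n : ℕ) : Set where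
  field
    m   : ℕ
    e   : ℕ
    end : Fin e → Bool → Vertex n m
    σ   : Dart n e → Dart n e
    σ⁻  : Dart n e → Dart n e
    F   : ℕ                                 -- number of faces of G'
    face : Dart n e → Fin F                 -- face to the left of each dart
open RawDiagram public

module _ {n : ℕ} (D : RawDiagram n) where

  vert : Dart n (e D) → Vertex n (m D)
  vert (cyc k false) = cycV k
  vert (cyc k true)  = cycV (cycSucc k)
  vert (gr j b)      = end D j b

  αD : Dart n (e D) → Dart n (e D)
  αD (cyc k b) = cyc k (not b)
  αD (gr j b)  = gr j (not b)

  φ : Dart n (e D) → Dart n (e D)
  φ x = σ D (αD x)

  -- paths in the diagram b itself (boundary cycle not used)
  data Path (u : Vertex n (m D)) : Vertex n (m D) → Set where
    here : Path u u
    step : (j : Fin (e D)) (b : Bool) → Path u (end D j b) → Path u (end D j (not b))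

  -- α(b): boundary points i, j lie in a common connected component of b
  αPart : Fin (2 * n) → Fin (2 * n) → Set
  αPart i j = Path (bd i) (bd j)

  record InB : Set where
    field
      σσ⁻      : ∀ x → σ D (σ⁻ D x) ≡ x
      σ⁻σ      : ∀ x → σ⁻ D (σ D x) ≡ x
      σ-vert   : ∀ x → vert (σ D x) ≡ vert x
      σ-orbit  : ∀ x y → vert x ≡ vert y → ∃[ k ] iter (σ D) k x ≡ y
      face-surj  : ∀ f → ∃[ x ] face D x ≡ f
      face-φ     : ∀ x → face D (φ x) ≡ face D x
      face-orbit : ∀ x y → face D x ≡ face D y → ∃[ k ] iter φ k x ≡ y
      -- planarity (Euler formula for the connected graph G'):
      -- V + F = E + 2 with V = 2n+1+m, E = (2n+1)+e
      euler    : (suc (2 * n) + m D) + F D ≡ (suc (2 * n) + e D) + 2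
      -- the outside of the rectangle is a face containing only boundary darts
      outer    : ∃[ f ] (∀ x → face D x ≡ f → IsCyc x)
      no-corner : ∀ j b → end D j b ≢ corner
      bd-val1  : ∀ i → ∃[ j ] ∃[ b ] (end D j b ≡ bd i ×
                   (∀ j' b' → end D j' b' ≡ bd i → (j' , b') ≡ (j , b)))
      no-inner-edge : ∀ j → ¬ (IsInner (end D j false) × IsInner (end D j true))
      inner-val3 : ∀ v → ∃[ d₁ ] ∃[ d₂ ] ∃[ d₃ ]
                     ( vert d₁ ≡ inner v × vert d₂ ≡ inner v × vert d₃ ≡ inner v
                     × d₁ ≢ d₂ × d₁ ≢ d₃ × d₂ ≢ d₃ )

-- Following
-- the edge at a boundary point p to its far end and rotating once around that end
-- leads to the next boundary point `next p` of the same block, so every block is a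
-- cycle of `next`; as inner vertices have at least two darts, `next` has no fixed
-- point, which rules out singletons.  The inner faces pass the boundary points in
-- one linear order (`rank`), and the face of the edge at p next meets the boundary
-- at the point τ p just below `next p`.  Call the map tight when, for every point k
-- that is not the top (highest-ranked point) of its block, the face of k lies
-- below `next k`.  Under tightness every `next`-cycle climbs to its top and wraps
-- around once, and a crossing a₁ < b₁ < a₂ < b₂ produces an infinite descent of
-- gaps (c, next c) straddled by b's block.  Tightness follows from Euler's formula
-- m + F = e + 2: an untight point would allow charging the inner vertices and the
-- faces to distinct edges plus one extra token.

module Submission where

open import Data.Bool using (Bool; true; false; not)
open import Data.Bool.Properties using (not-involutive; not-¬; ¬-not) renaming (_≟_ to _≟B_)
open import Data.Empty using (⊥; ⊥-elim)
open import Data.Fin using (Fin; zero; suc; toℕ; inject₁; fromℕ; opposite; splitAt; join)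
open import Data.Fin.Induction using (<-weakInduction; <-weakInduction-startingFrom)
import Data.Fin.Properties as Fin
open import Data.Fin.Properties
  using ( toℕ-injective; toℕ<n; toℕ-inject₁; toℕ-fromℕ; ≤fromℕ; any?; injective⇒≤; join-splitAt
        ; opposite-prop; opposite-involutive )
  renaming (_≟_ to _≟F_)
open import Data.Fin.Relation.Unary.Top using (view; ‵fromℕ; ‵inject₁)
open import Data.Nat using (ℕ; zero; suc; _+_; _*_; _<_; _≤_; _<?_; _≤?_; z≤n; s≤s)
open import Data.Nat.Properties
open import Data.Product using (∃; ∃-syntax; _×_; _,_; proj₁; proj₂)
open import Data.Sum using (_⊎_; inj₁; inj₂; [_,_])
open import Data.Unit using (⊤; tt)
open import Function using (_∘_)
open import Level using (0ℓ)
open import Relation.Binary using (Symmetric; Transitive; IsEquivalence; tri<; tri≈; tri>)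
  renaming (Decidable to Decidable₂)
open import Relation.Binary.PropositionalEquality
  using (_≡_; _≢_; refl; sym; trans; cong; cong₂; subst; subst₂; module ≡-Reasoning)
open import Relation.Nullary using (¬_; Dec; yes; no)
open import Relation.Unary using (Pred; Decidable)
open import Defs

iter-exit : ∀ {A : Set} {P : Pred A 0ℓ} (f : A → A) → Decidable P →
            ∀ i {x} → P x → ¬ P (iter f i x) →
            ∃[ j ] P (iter f j x) × ¬ P (f (iter f j x))
iter-exit f P? zero px ¬pi = ⊥-elim (¬pi px)
iter-exit f P? (suc i) {x} px ¬pi with P? (iter f i x)
... | yes pi  = i , pi , ¬pi
... | no ¬pi′ = iter-exit f P? i px ¬pi′

iter-shift : ∀ {A : Set} (f : A → A) k x → iter f k (f x) ≡ iter f (suc k) x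
iter-shift f zero    x = refl
iter-shift f (suc k) x = cong f (iter-shift f k x)

iter-fixed : ∀ {A : Set} {f : A → A} {x} → f x ≡ x → ∀ k → iter f k x ≡ x
iter-fixed fx zero    = refl
iter-fixed {f = f} fx (suc k) = trans (cong f (iter-fixed fx k)) fx

iter-swap : ∀ {A : Set} {f : A → A} {a b} → f a ≡ b → f b ≡ a →
            ∀ k → iter f k a ≡ a ⊎ iter f k a ≡ b
iter-swap ab ba zero = inj₁ refl
iter-swap {f = f} ab ba (suc k) with iter-swap ab ba k
... | inj₁ e = inj₂ (trans (cong f e) ab)
... | inj₂ e = inj₁ (trans (cong f e) ba)

splitAt-injective : ∀ m {n} {i j : Fin (m + n)} → splitAt m i ≡ splitAt m j → i ≡ j
splitAt-injective m {n} {i} {j} e =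
  trans (sym (join-splitAt m n i)) (trans (cong (join m n) e) (join-splitAt m n j))

cycSucc-inject₁ : ∀ {K} (i : Fin K) → cycSucc (inject₁ i) ≡ suc i
cycSucc-inject₁ {suc K} zero = refl
cycSucc-inject₁ {suc K} (suc i) rewrite cycSucc-inject₁ i = refl

cycSucc-fromℕ : ∀ K → cycSucc (fromℕ K) ≡ zero
cycSucc-fromℕ zero = refl
cycSucc-fromℕ (suc K) rewrite cycSucc-fromℕ K = refl

cycPred : ∀ {K} → Fin (suc K) → Fin (suc K)
cycPred zero    = fromℕ _
cycPred (suc i) = inject₁ i

cycPred-cycSucc : ∀ {K} (k : Fin (suc K)) → cycPred (cycSucc k) ≡ k
cycPred-cycSucc k with view k
... | ‵fromℕ     = cong cycPred (cycSucc-fromℕ _)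
... | ‵inject₁ i = cong cycPred (cycSucc-inject₁ i)

cycSucc-injective : ∀ {K} {i j : Fin (suc K)} → cycSucc i ≡ cycSucc j → i ≡ j
cycSucc-injective {i = i} {j} eq =
  trans (sym (cycPred-cycSucc i)) (trans (cong cycPred eq) (cycPred-cycSucc j))

toℕ-cycPred : ∀ {K} (p : Fin (suc K)) →
              suc (toℕ (cycPred p)) ≡ toℕ p ⊎ (toℕ p ≡ 0 × suc (toℕ (cycPred p)) ≡ suc K)
toℕ-cycPred zero    = inj₂ (refl , cong suc (toℕ-fromℕ _))
toℕ-cycPred (suc p) = inj₁ (cong suc (toℕ-inject₁ p))

cycPred-up : ∀ {K} (p : Fin (suc K)) → suc (toℕ p) < suc K →
             ∃[ q ] cycPred q ≡ p × toℕ q ≡ suc (toℕ p)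
cycPred-up p lt with view p
... | ‵fromℕ     = ⊥-elim (<-irrefl (cong suc (toℕ-fromℕ _)) lt)
... | ‵inject₁ i = suc i , refl , cong suc (sym (toℕ-inject₁ i))

opposite-injective : ∀ {K} {p q : Fin K} → opposite p ≡ opposite q → p ≡ q
opposite-injective {p = p} {q} e =
  trans (sym (opposite-involutive p)) (trans (cong opposite e) (opposite-involutive q))

opposite-inject₁ : ∀ {K} (i : Fin K) → opposite (inject₁ i) ≡ suc (opposite i)
opposite-inject₁ {suc K} zero    = refl
opposite-inject₁ {suc K} (suc i) = cong inject₁ (opposite-inject₁ i)

opposite-fromℕ : ∀ K → opposite (fromℕ K) ≡ zero
opposite-fromℕ zero    = refl
opposite-fromℕ (suc K) = cong inject₁ (opposite-fromℕ K)

opposite-cycSucc : ∀ {K} (p : Fin (suc K)) → opposite (cycSucc p) ≡ cycPred (opposite p)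
opposite-cycSucc p with view p
... | ‵fromℕ     = trans (cong opposite (cycSucc-fromℕ _)) (cong cycPred (sym (opposite-fromℕ _)))
... | ‵inject₁ i = trans (cong opposite (cycSucc-inject₁ i)) (cong cycPred (sym (opposite-inject₁ i)))

cycSucc-up : ∀ {K} (p : Fin (suc K)) → suc (toℕ (opposite p)) < suc K →
             ∃[ q ] cycSucc q ≡ p × toℕ (opposite q) ≡ suc (toℕ (opposite p))
cycSucc-up p lt with cycPred-up (opposite p) lt
... | q , e , r = opposite q ,
  opposite-injective (trans (opposite-cycSucc (opposite q)) (trans (cong cycPred (opposite-involutive q)) e)) ,
  trans (cong toℕ (opposite-involutive q)) r

opposite-antitone : ∀ {K} (p q : Fin K) → toℕ p < toℕ q → toℕ (opposite q) < toℕ (opposite p)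
opposite-antitone p q lt rewrite opposite-prop p | opposite-prop q = ∸-monoʳ-< (s≤s lt) (toℕ<n q)

cycSucc-closed : ∀ {K} (Q : Pred (Fin (suc K)) 0ℓ) {k₀} → Q k₀ →
                 (∀ k → Q k → Q (cycSucc k)) → ∀ k → Q k
cycSucc-closed {K} Q {k₀} q₀ closed = <-weakInduction Q Q-zero step-suc
  where
  step-suc : ∀ i → Q (inject₁ i) → Q (suc i)
  step-suc i q = subst Q (cycSucc-inject₁ i) (closed _ q)
  Q-zero : Q zero
  Q-zero = subst Q (cycSucc-fromℕ K)
             (closed _ (<-weakInduction-startingFrom Q q₀ step-suc (≤fromℕ k₀)))

-- The complement of a backward-closed set is forward-closed.
cycSucc-coclosed : ∀ {K} (Q : Pred (Fin (suc K)) 0ℓ) → Decidable Q → ∀ {k₀} → Q k₀ →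
                   (∀ k → Q (cycSucc k) → Q k) → ∀ k → Q k
cycSucc-coclosed Q Q? q₀ coclosed k with Q? k
... | yes qk = qk
... | no ¬qk = ⊥-elim (cycSucc-closed (¬_ ∘ Q) ¬qk (λ k′ ¬q q → ¬q (coclosed k′ q)) _ q₀)

argmax : ∀ {N} {P : Pred (Fin N) 0ℓ} → Decidable P → (r : Fin N → ℕ) → ∃ P →
         ∃[ t ] P t × (∀ q → P q → r q ≤ r t)
argmax {zero} P? r (() , _)
argmax {suc N} {P} P? r (w , pw) with any? (P? ∘ suc)
... | no none = zero , P-zero w pw , λ { zero _ → ≤-refl ; (suc q) pq → ⊥-elim (none (q , pq)) }
  where
  P-zero : ∀ w → P w → P zero
  P-zero zero    pw = pw
  P-zero (suc w) pw = ⊥-elim (none (w , pw))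
... | yes some with argmax (P? ∘ suc) (r ∘ suc) some | P? zero
...   | t , pt , max | no ¬p0 = suc t , pt , λ { zero p0 → ⊥-elim (¬p0 p0) ; (suc q) pq → max q pq }
...   | t , pt , max | yes p0 with r zero ≤? r (suc t)
...     | yes le = suc t , pt , λ { zero _ → le ; (suc q) pq → max q pq }
...     | no ¬le = zero , p0 ,
                 λ { zero _ → ≤-refl ; (suc q) pq → ≤-trans (max q pq) (<⇒≤ (≰⇒> ¬le)) }

-- Circular versus linear crossings

NoLinearCrossing : ∀ {N} → (Fin N → ℕ) → (Fin N → Fin N → Set) → Set
NoLinearCrossing pos R = ∀ a₁ a₂ b₁ b₂ → R a₁ a₂ → R b₁ b₂ → ¬ R a₁ b₁ →
  pos a₁ < pos b₁ → pos b₁ < pos a₂ → pos a₂ < pos b₂ → ⊥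

module _ {N} {R : Fin N → Fin N → Set} (R-sym : Symmetric R) (R-trans : Transitive R) where

  NoLinearCrossing-reindex : (pos pos′ : Fin N → ℕ) →
    (∀ p q → pos p < pos q → pos′ p < pos′ q) ⊎ (∀ p q → pos p < pos q → pos′ q < pos′ p) →
    NoLinearCrossing pos′ R → NoLinearCrossing pos R
  NoLinearCrossing-reindex pos pos′ (inj₁ mono) nc a₁ a₂ b₁ b₂ ra rb ¬ab l₁ l₂ l₃ =
    nc a₁ a₂ b₁ b₂ ra rb ¬ab (mono _ _ l₁) (mono _ _ l₂) (mono _ _ l₃)
  NoLinearCrossing-reindex pos pos′ (inj₂ anti) nc a₁ a₂ b₁ b₂ ra rb ¬ab l₁ l₂ l₃ =
    nc b₂ b₁ a₂ a₁ (R-sym rb) (R-sym ra) (λ r → ¬ab (R-trans ra (R-sym (R-trans rb r))))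
       (anti _ _ l₃) (anti _ _ l₂) (anti _ _ l₁)

  NoLinearCrossing⇒¬Interleaved : NoLinearCrossing toℕ R → ∀ x y u v → R x y → R u v → ¬ R x u →
    x ≢ y → Between x y u → Between y x v → ⊥
  NoLinearCrossing⇒¬Interleaved nc x y u v rxy ruv ¬xu x≢y (inj₁ (xu , uy)) (inj₁ (yv , vx)) =
    <-asym (<-trans xu uy) (<-trans yv vx)
  NoLinearCrossing⇒¬Interleaved nc x y u v rxy ruv ¬xu x≢y (inj₁ (xu , uy)) (inj₂ (_ , inj₁ yv)) =
    nc x y u v rxy ruv ¬xu xu uy yv
  NoLinearCrossing⇒¬Interleaved nc x y u v rxy ruv ¬xu x≢y (inj₁ (xu , uy)) (inj₂ (_ , inj₂ vx)) =
    nc v u x y (R-sym ruv) rxy (λ r → ¬xu (R-trans (R-sym r) (R-sym ruv))) vx xu uy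
  NoLinearCrossing⇒¬Interleaved nc x y u v rxy ruv ¬xu x≢y (inj₂ (yx , _)) (inj₂ (xy , _)) =
    x≢y (toℕ-injective (≤-antisym xy yx))
  NoLinearCrossing⇒¬Interleaved nc x y u v rxy ruv ¬xu x≢y (inj₂ (_ , inj₁ xu)) (inj₁ (yv , vx)) =
    nc y x v u (R-sym rxy) (R-sym ruv) (λ r → ¬xu (R-trans rxy (R-trans r (R-sym ruv)))) yv vx xu
  NoLinearCrossing⇒¬Interleaved nc x y u v rxy ruv ¬xu x≢y (inj₂ (_ , inj₂ uy)) (inj₁ (yv , vx)) =
    nc u v y x ruv (R-sym rxy) (λ r → ¬xu (R-sym (R-trans r (R-sym rxy)))) uy yv vx

  NoLinearCrossing⇒NonCrossing : NoLinearCrossing toℕ R → NonCrossing R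
  NoLinearCrossing⇒NonCrossing nc x y u v (rxy , x≢y , _) (ruv , _ , _) ¬xu (inj₁ (b₁ , b₂)) =
    NoLinearCrossing⇒¬Interleaved nc x y u v rxy ruv ¬xu x≢y b₁ b₂
  NoLinearCrossing⇒NonCrossing nc x y u v (rxy , x≢y , _) (ruv , _ , _) ¬xu (inj₂ (b₁ , b₂)) =
    NoLinearCrossing⇒¬Interleaved nc x y v u rxy (R-sym ruv) (λ r → ¬xu (R-trans r (R-sym ruv)))
      x≢y b₁ b₂

-- Blocks and faces on ranked points

module RankedBlocksAndFaces
  {N : ℕ} {Face : Set}
  (rank : Fin N → ℕ) (rank-injective : ∀ {p q} → rank p ≡ rank q → p ≡ q)
  {_∼_ : Fin N → Fin N → Set} (∼-isEquivalence : IsEquivalence _∼_) (_∼?_ : Decidable₂ _∼_)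
  (next : Fin N → Fin N)
  (∼-next : ∀ p → p ∼ next p)
  (∼⇒next-reachable : ∀ {p q} → p ∼ q → ∃[ i ] iter next i p ≡ q)
  (τ : Fin N → Fin N)
  (rank-τ : ∀ p → suc (rank (τ p)) ≡ rank (next p) ⊎ (rank (next p) ≡ 0 × suc (rank (τ p)) ≡ N))
  (face : Fin N → Face)
  (face-τ : ∀ p → face (τ p) ≡ face p)
  (face⇒τ-reachable : ∀ {p q} → face p ≡ face q → ∃[ i ] iter τ i p ≡ q)
  where

  open IsEquivalence ∼-isEquivalence renaming (refl to ∼-refl; sym to ∼-sym; trans to ∼-trans)

  NotTop : Fin N → Set
  NotTop k = ∃[ q ] k ∼ q × rank k < rank q

  Tight : Set
  Tight = ∀ k q → NotTop k → face q ≡ face k → rank q < rank (next k)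

  ∼-iter-next : ∀ i p → p ∼ iter next i p
  ∼-iter-next zero    p = ∼-refl
  ∼-iter-next (suc i) p = ∼-trans (∼-iter-next i p) (∼-next _)

  face-iter-τ : ∀ i p → face (iter τ i p) ≡ face p
  face-iter-τ zero    p = refl
  face-iter-τ (suc i) p = trans (face-τ _) (face-iter-τ i p)

  gap-around : ∀ {a a′} x → a ∼ a′ → (∀ c → a ∼ c → rank c ≢ x) → rank a < x → x < rank a′ →
               ∃[ c ] a ∼ c × rank c < x × x < rank (next c)
  gap-around {a} x aa′ ≢x a<x x<a′ with ∼⇒next-reachable aa′
  ... | i , refl with iter-exit next (λ z → rank z <? x) i a<x (<-asym x<a′)
  ...   | j , c<x , ¬nc<x =
    iter next j a , ∼-iter-next j a , c<x ,
    ≤∧≢⇒< (≮⇒≥ ¬nc<x) (λ e → ≢x _ (∼-iter-next (suc j) a) (sym e))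

  face-descent : ∀ {s p} y → face s ≡ face p → y ≤ rank s → rank p < y →
                 ∃[ t ] face t ≡ face s × y ≤ rank t × rank (τ t) < y
  face-descent {s} y fsp y≤s p<y with face⇒τ-reachable fsp
  ... | i , refl with iter-exit τ (λ z → y ≤? rank z) i y≤s (<⇒≱ p<y)
  ...   | j , y≤t , ¬y≤τt = iter τ j s , face-iter-τ j s , y≤t , ≰⇒> ¬y≤τt

  below-next⇒≤τ : ∀ {a y} → rank a < rank (next a) → y < rank (next a) → y ≤ rank (τ a)
  below-next⇒≤τ {a} a<na y<na with rank-τ a
  ... | inj₁ e          = ≤-pred (subst (_ <_) (sym e) y<na)
  ... | inj₂ (na≡0 , _) = ⊥-elim (n≮0 (subst (rank a <_) na≡0 a<na))

  τ-below⇒next≤ : ∀ {p y} → rank (τ p) < y → rank (next p) ≤ y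
  τ-below⇒next≤ {p} τp<y with rank-τ p
  ... | inj₁ e          = subst (_≤ _) e τp<y
  ... | inj₂ (np≡0 , _) = subst (_≤ _) (sym np≡0) z≤n

  module _ (tight : Tight) where

    rank<rank-next : ∀ {k} → NotTop k → rank k < rank (next k)
    rank<rank-next nt = tight _ _ nt refl

    -- Walk down the face of a, from τ a (just below next a) to a (below b).
    top-below-gap : ∀ {a b} → rank a < rank b → rank b < rank (next a) →
      ∃[ p ] ¬ NotTop p × rank (next p) ≤ rank b × rank b ≤ rank p × rank p < rank (next a)
    top-below-gap {a} {b} a<b b<na
      with face-descent (rank b) (face-τ a) (below-next⇒≤τ (<-trans a<b b<na) b<na) a<b
    ... | p , fp , b≤p , τp<b = p , top , np≤b , b≤p , p<na
      where
      p<na : rank p < rank (next a)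
      p<na = tight a p (next a , ∼-next a , <-trans a<b b<na) (trans fp (face-τ a))
      np≤b : rank (next p) ≤ rank b
      np≤b = τ-below⇒next≤ τp<b
      top : ¬ NotTop p
      top nt = <⇒≱ (rank<rank-next nt) (≤-trans np≤b b≤p)

    -- The top p found above has its own wrap-around gap (next p, p) containing b, so
    -- some gap (c, next c) of p's block contains b, and next c ≤ p < next a.
    gap-escape-impossible : ∀ fuel {a b b′} → rank (next a) < fuel →
      rank a < rank b → rank b < rank (next a) → ¬ a ∼ b → b ∼ b′ → rank (next a) < rank b′ → ⊥
    gap-escape-impossible (suc fuel) {a} {b} {b′} na<fuel a<b b<na ¬ab bb′ na<b′
      with top-below-gap a<b b<na
    ... | p , top , np≤b , b≤p , p<na =
      descend (gap-around (rank b) (∼-sym (∼-next p)) (λ c npc → off-b c (∼-trans (∼-next p) npc))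
                (≤∧≢⇒< np≤b (off-b _ (∼-next p))) (≤∧≢⇒< b≤p (λ e → off-b p ∼-refl (sym e))))
      where
      ¬pb : ¬ p ∼ b
      ¬pb pb = top (b′ , ∼-trans pb bb′ , <-trans p<na na<b′)
      off-b : ∀ c → p ∼ c → rank c ≢ rank b
      off-b c pc e = ¬pb (subst (p ∼_) (rank-injective e) pc)
      descend : ∃[ c ] next p ∼ c × rank c < rank b × rank b < rank (next c) → ⊥
      descend (c , npc , c<b , b<nc) =
        gap-escape-impossible fuel (≤-trans nc<na (≤-pred na<fuel)) c<b b<nc
          (λ cb → ¬pb (∼-trans pc cb)) bb′ (<-trans nc<na na<b′)
        where
        pc : p ∼ c
        pc = ∼-trans (∼-next p) npc
        nc<na : rank (next c) < rank (next a)
        nc<na = ≤-<-trans (≮⇒≥ (λ p<nc → top (next c , ∼-trans pc (∼-next c) , p<nc))) p<na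

    interleaved-impossible : ∀ {a₁ a₂ b b′} → a₁ ∼ a₂ → ¬ a₁ ∼ b →
      rank a₁ < rank b → rank b < rank a₂ → b ∼ b′ → (∀ q → a₁ ∼ q → rank q < rank b′) → ⊥
    interleaved-impossible {a₁} aa₂ ¬ab a₁<b b<a₂ bb′ below
      with gap-around _ aa₂ (λ c ac e → ¬ab (subst (a₁ ∼_) (rank-injective e) ac)) a₁<b b<a₂
    ... | c , ac , c<b , b<nc =
      gap-escape-impossible _ (n<1+n _) c<b b<nc (λ cb → ¬ab (∼-trans ac cb)) bb′
        (below _ (∼-trans ac (∼-next c)))

    noLinearCrossing : NoLinearCrossing rank _∼_
    noLinearCrossing a₁ a₂ b₁ b₂ aa bb ¬ab l₁ l₂ l₃
      with argmax (a₁ ∼?_) rank (a₁ , ∼-refl) | argmax (b₁ ∼?_) rank (b₁ , ∼-refl)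
    ... | tA , atA , maxA | tB , btB , maxB with <-cmp (rank tA) (rank tB)
    ... | tri< tA<tB _ _ =
      interleaved-impossible aa ¬ab l₁ l₂ btB (λ q aq → ≤-<-trans (maxA q aq) tA<tB)
    ... | tri≈ _ e _ =
      ¬ab (∼-trans atA (subst (_∼ b₁) (sym (rank-injective e)) (∼-sym btB)))
    ... | tri> _ _ tB<tA =
      interleaved-impossible bb (λ ba → ¬ab (∼-trans aa (∼-sym ba))) l₂ l₃
        (∼-trans (∼-sym aa) atA) (λ q bq → ≤-<-trans (maxB q bq) tB<tA)

-- The rotation system of a diagram in B_n

module Diagram {n′ : ℕ} (D : RawDiagram (suc n′)) (ib : InB D) where

  open InB ib

  N : ℕ
  N = 2 * suc n′

  Darts : Set
  Darts = Dart (suc n′) (e D)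

  σ-injective : ∀ {x y} → σ D x ≡ σ D y → x ≡ y
  σ-injective {x} {y} eq = trans (sym (σ⁻σ x)) (trans (cong (σ⁻ D) eq) (σ⁻σ y))

  σ-fixed⇒alone : ∀ {x} → σ D x ≡ x → ∀ y → vert D x ≡ vert D y → x ≡ y
  σ-fixed⇒alone {x} fx y v with σ-orbit x y v
  ... | k , eq = trans (sym (iter-fixed fx k)) eq

  σ-two-darts : ∀ {a b} → a ≢ b → vert D b ≡ vert D a →
                (∀ x → vert D x ≡ vert D a → x ≡ a ⊎ x ≡ b) → σ D a ≡ b
  σ-two-darts {a} {b} a≢b vb only with only (σ D a) (σ-vert a)
  ... | inj₁ aa = ⊥-elim (a≢b (σ-fixed⇒alone aa b (sym vb)))
  ... | inj₂ ab = ab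

  σ-three-darts : ∀ {a b c} → a ≢ b → a ≢ c → b ≢ c → vert D b ≡ vert D a → vert D c ≡ vert D a →
                  (∀ x → vert D x ≡ vert D a → x ≡ a ⊎ x ≡ b ⊎ x ≡ c) →
                  σ D a ≡ b → σ D b ≡ c × σ D c ≡ a
  σ-three-darts {a} {b} {c} a≢b a≢c b≢c vb vc only ab with only (σ D b) (trans (σ-vert b) vb)
  ... | inj₁ ba with σ-orbit a c (sym vc)
  ...   | k , ek with iter-swap ab ba k
  ...     | inj₁ e = ⊥-elim (a≢c (trans (sym e) ek))
  ...     | inj₂ e = ⊥-elim (b≢c (trans (sym e) ek))
  σ-three-darts {a} {b} {c} a≢b a≢c b≢c vb vc only ab | inj₂ (inj₁ bb) =
    ⊥-elim (a≢b (sym (σ-fixed⇒alone bb a vb)))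
  σ-three-darts {a} {b} {c} a≢b a≢c b≢c vb vc only ab | inj₂ (inj₂ bc)
    with only (σ D c) (trans (σ-vert c) vc)
  ... | inj₁ ca        = bc , ca
  ... | inj₂ (inj₁ cb) = ⊥-elim (a≢c (σ-injective (trans ab (sym cb))))
  ... | inj₂ (inj₂ cc) = ⊥-elim (a≢c (sym (σ-fixed⇒alone cc a vc)))

  edgeAt : Fin N → Fin (e D)
  edgeAt p = proj₁ (bd-val1 p)

  sideAt : Fin N → Bool
  sideAt p = proj₁ (proj₂ (bd-val1 p))

  G : Fin N → Darts
  G p = gr (edgeAt p) (sideAt p)

  vert-G : ∀ p → vert D (G p) ≡ bd p
  vert-G p = proj₁ (proj₂ (proj₂ (bd-val1 p)))

  G-unique : ∀ p j b → end D j b ≡ bd p → gr j b ≡ G p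
  G-unique p j b eq with proj₂ (proj₂ (proj₂ (bd-val1 p))) j b eq
  ... | refl = refl

  G-injective : ∀ {p q} → G p ≡ G q → p ≡ q
  G-injective {p} {q} e with trans (sym (vert-G p)) (trans (cong (vert D) e) (vert-G q))
  ... | refl = refl

  -- Cycle vertex k + 1 is boundary point bd k, so I p arrives at bd p along cycle
  -- edge p and O p leaves it along cycle edge p + 1.
  I O : Fin N → Darts
  I p = cyc (inject₁ p) true
  O p = cyc (suc p) false

  cornerOut cornerIn : Darts
  cornerOut = cyc zero false
  cornerIn  = cyc (fromℕ N) true

  vert-I : ∀ p → vert D (I p) ≡ bd p
  vert-I p rewrite cycSucc-inject₁ p = refl

  cycV-injective : ∀ {i j : Fin (suc N)} → cycV {suc n′} {m D} i ≡ cycV j → i ≡ j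
  cycV-injective {zero}  {zero}  _    = refl
  cycV-injective {suc i} {suc j} refl = refl

  darts-at-bd : ∀ p x → vert D x ≡ bd p → x ≡ I p ⊎ x ≡ O p ⊎ x ≡ G p
  darts-at-bd p (cyc k false) v with cycV-injective {k} {suc p} v
  ... | refl = inj₂ (inj₁ refl)
  darts-at-bd p (cyc k true) v
    with cycSucc-injective {i = k} {inject₁ p} (trans (cycV-injective v) (sym (cycSucc-inject₁ p)))
  ... | refl = inj₁ refl
  darts-at-bd p (gr j b) v = inj₂ (inj₂ (G-unique p j b v))

  vert-cornerIn : vert D cornerIn ≡ corner
  vert-cornerIn = cong cycV (cycSucc-fromℕ N)

  darts-at-corner : ∀ x → vert D x ≡ corner → x ≡ cornerOut ⊎ x ≡ cornerIn
  darts-at-corner (cyc k false) v with cycV-injective {k} {zero} v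
  ... | refl = inj₁ refl
  darts-at-corner (cyc k true) v
    with cycSucc-injective {i = k} {fromℕ N} (trans (cycV-injective {j = zero} v) (sym (cycSucc-fromℕ N)))
  ... | refl = inj₂ refl
  darts-at-corner (gr j b) v = ⊥-elim (no-corner j b v)

  σ-cornerOut : σ D cornerOut ≡ cornerIn
  σ-cornerOut = σ-two-darts (λ ()) vert-cornerIn darts-at-corner

  σ-cornerIn : σ D cornerIn ≡ cornerOut
  σ-cornerIn = σ-two-darts (λ ()) (sym vert-cornerIn)
    (λ x v → Data.Sum.swap (darts-at-corner x (trans v vert-cornerIn)))

  data FaceWalk : Darts → Fin N → Set where
    arrive : ∀ q → FaceWalk (G q) q
    pass   : ∀ {x t} → (∀ q → x ≢ G q) → FaceWalk (φ D x) t → FaceWalk x t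

  pass-cyc : ∀ {x t} → IsCyc x → FaceWalk (φ D x) t → FaceWalk x t
  pass-cyc {cyc _ _} _ w = pass (λ q ()) w

  pass-to : ∀ {x q} → IsCyc x → φ D x ≡ G q → FaceWalk x q
  pass-to cx e = pass-cyc cx (subst (λ z → FaceWalk z _) (sym e) (arrive _))

  face-walk : ∀ {x t} → FaceWalk x t → face D x ≡ face D (G t)
  face-walk (arrive q)     = refl
  face-walk (pass {x} _ w) = trans (sym (face-φ x)) (face-walk w)

  -- The direction in which inner faces run along the boundary cycle depends on
  -- whether the outer face consists of the outgoing or of the arriving cycle darts
  -- (OuterOutgoing and OuterArriving below); the record abstracts from it.
  record Orientation : Set where
    field
      outerFace : Fin (F D)
      down : Fin N → Fin N
      rank : Fin N → ℕ
      rank-injective : ∀ {p q} → rank p ≡ rank q → p ≡ q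
      rank<N : ∀ p → rank p < N
      rank-down : ∀ p → suc (rank (down p)) ≡ rank p ⊎ (rank p ≡ 0 × suc (rank (down p)) ≡ N)
      up : ∀ p → suc (rank p) < N → ∃[ q ] down q ≡ p × rank q ≡ suc (rank p)
      walk-σG : ∀ p → FaceWalk (σ D (G p)) (down p)
      cyc-outer-or-walk : ∀ x → IsCyc x → face D x ≡ outerFace ⊎ ∃ (FaceWalk x)
      rank-monotone : (∀ p q → toℕ p < toℕ q → rank p < rank q) ⊎
                      (∀ p q → toℕ p < toℕ q → rank q < rank p)

  cyc-true≢cyc-false : ∀ {k k′} → _≢_ {A = Darts} (cyc k true) (cyc k′ false)
  cyc-true≢cyc-false ()

  cyc-darts-at : ∀ x w → IsCyc x → vert D x ≡ cycV w →
                 x ≡ cyc w false ⊎ ∃[ k ] x ≡ cyc k true × cycSucc k ≡ w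
  cyc-darts-at (cyc k false) w _ v with cycV-injective {k} {w} v
  ... | refl = inj₁ refl
  cyc-darts-at (cyc k true) w _ v = inj₂ (k , refl , cycV-injective v)

  module OuterOutgoing (f₀ : Fin (F D)) (outer-cyc : ∀ x → face D x ≡ f₀ → IsCyc x)
                       {k₀} (h₀ : face D (cyc k₀ false) ≡ f₀) where

    -- The outer face has no dart of b, so it continues from an outgoing cycle dart to
    -- the next one; hence it contains them all and σ is I ↦ O ↦ G ↦ I at every bd p.
    σ-arriving : ∀ k → face D (cyc k false) ≡ f₀ → σ D (cyc k true) ≡ cyc (cycSucc k) false
    σ-arriving k hk with cyc-darts-at (σ D (cyc k true)) (cycSucc k)
                           (outer-cyc _ (trans (face-φ (cyc k false)) hk)) (σ-vert (cyc k true))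
    ... | inj₁ e = e
    ... | inj₂ (k′ , e , s) with cycSucc-injective {i = k′} {k} s
    ...   | refl = ⊥-elim (cyc-true≢cyc-false (σ-fixed⇒alone e (cyc (cycSucc k) false) refl))

    all-outgoing-outer : ∀ k → face D (cyc k false) ≡ f₀
    all-outgoing-outer = cycSucc-closed (λ k → face D (cyc k false) ≡ f₀) h₀
      (λ k hk → trans (cong (face D) (sym (σ-arriving k hk))) (trans (face-φ (cyc k false)) hk))

    σ-IO : ∀ p → σ D (I p) ≡ O p
    σ-IO p = trans (σ-arriving (inject₁ p) (all-outgoing-outer _))
                   (cong (λ z → cyc z false) (cycSucc-inject₁ p))

    σ-at-bd : ∀ p → σ D (O p) ≡ G p × σ D (G p) ≡ I p
    σ-at-bd p = σ-three-darts (λ ()) (λ ()) (λ ()) (sym (vert-I p)) (trans (vert-G p) (sym (vert-I p)))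
                  (λ x v → darts-at-bd p x (trans v (vert-I p))) (σ-IO p)

    walk-I : ∀ p → FaceWalk (I p) (cycPred p)
    walk-I zero    = pass-cyc tt (subst (λ z → FaceWalk z _) (sym σ-cornerOut)
                       (pass-to tt (proj₁ (σ-at-bd (fromℕ _)))))
    walk-I (suc p) = pass-to tt (proj₁ (σ-at-bd (inject₁ p)))

    cyc-outer-or-walk : ∀ x → IsCyc x → face D x ≡ f₀ ⊎ ∃ (FaceWalk x)
    cyc-outer-or-walk (cyc k false) _ = inj₁ (all-outgoing-outer k)
    cyc-outer-or-walk (cyc k true)  _ with view k
    ... | ‵fromℕ     = inj₂ (_ , pass-to tt (proj₁ (σ-at-bd (fromℕ _))))
    ... | ‵inject₁ p = inj₂ (_ , walk-I p)

    orientation : Orientation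
    orientation = record
      { outerFace = f₀ ; down = cycPred ; rank = toℕ
      ; rank-injective = toℕ-injective ; rank<N = toℕ<n ; rank-down = toℕ-cycPred ; up = cycPred-up
      ; walk-σG = λ p → subst (λ z → FaceWalk z _) (sym (proj₂ (σ-at-bd p))) (walk-I p)
      ; cyc-outer-or-walk = cyc-outer-or-walk
      ; rank-monotone = inj₁ (λ _ _ lt → lt)
      }

  module OuterArriving (f₀ : Fin (F D)) (outer-cyc : ∀ x → face D x ≡ f₀ → IsCyc x)
                       {k₀} (h₀ : face D (cyc k₀ true) ≡ f₀) where

    σ-leaving : ∀ k → face D (cyc (cycSucc k) true) ≡ f₀ → σ D (cyc (cycSucc k) false) ≡ cyc k true
    σ-leaving k hk with cyc-darts-at (σ D (cyc (cycSucc k) false)) (cycSucc k)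
                          (outer-cyc _ (trans (face-φ (cyc (cycSucc k) true)) hk)) (σ-vert _)
    ... | inj₁ e = ⊥-elim (cyc-true≢cyc-false (sym (σ-fixed⇒alone e (cyc k true) refl)))
    ... | inj₂ (k′ , e , s) with cycSucc-injective {i = k′} {k} s
    ...   | refl = e

    all-arriving-outer : ∀ k → face D (cyc k true) ≡ f₀
    all-arriving-outer =
      cycSucc-coclosed (λ k → face D (cyc k true) ≡ f₀) (λ k → face D (cyc k true) ≟F f₀) h₀
      (λ k hk → trans (cong (face D) (sym (σ-leaving k hk))) (trans (face-φ (cyc (cycSucc k) true)) hk))

    σ-OI : ∀ p → σ D (O p) ≡ I p
    σ-OI p = subst (λ z → σ D (cyc z false) ≡ I p) (cycSucc-inject₁ p)
               (σ-leaving (inject₁ p) (all-arriving-outer _))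

    σ-at-bd : ∀ p → σ D (I p) ≡ G p × σ D (G p) ≡ O p
    σ-at-bd p = σ-three-darts (λ ()) (λ ()) (λ ()) (vert-I p) (vert-G p)
                  (λ x v → [ inj₂ ∘ inj₁ , [ inj₁ , inj₂ ∘ inj₂ ] ] (darts-at-bd p x v)) (σ-OI p)

    walk-O : ∀ p → FaceWalk (O p) (cycSucc p)
    walk-O p with view p
    ... | ‵fromℕ     = subst (FaceWalk (O (fromℕ _))) (sym (cycSucc-fromℕ _))
                         (pass-cyc tt (subst (λ z → FaceWalk z _) (sym σ-cornerIn)
                           (pass-to tt (proj₁ (σ-at-bd zero)))))
    ... | ‵inject₁ i = subst (FaceWalk (O (inject₁ i))) (sym (cycSucc-inject₁ i))
                         (pass-to tt (proj₁ (σ-at-bd (suc i))))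

    cyc-outer-or-walk : ∀ x → IsCyc x → face D x ≡ f₀ ⊎ ∃ (FaceWalk x)
    cyc-outer-or-walk (cyc k true)        _ = inj₁ (all-arriving-outer k)
    cyc-outer-or-walk (cyc zero false)    _ = inj₂ (_ , pass-to tt (proj₁ (σ-at-bd zero)))
    cyc-outer-or-walk (cyc (suc p) false) _ = inj₂ (_ , walk-O p)

    rank-down : ∀ p → suc (toℕ (opposite (cycSucc p))) ≡ toℕ (opposite p) ⊎
                      (toℕ (opposite p) ≡ 0 × suc (toℕ (opposite (cycSucc p))) ≡ N)
    rank-down p rewrite opposite-cycSucc p = toℕ-cycPred (opposite p)

    orientation : Orientation
    orientation = record
      { outerFace = f₀ ; down = cycSucc ; rank = toℕ ∘ opposite
      ; rank-injective = opposite-injective ∘ toℕ-injective ; rank<N = toℕ<n ∘ opposite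
      ; rank-down = rank-down ; up = cycSucc-up
      ; walk-σG = λ p → subst (λ z → FaceWalk z _) (sym (proj₂ (σ-at-bd p))) (walk-O p)
      ; cyc-outer-or-walk = cyc-outer-or-walk
      ; rank-monotone = inj₂ opposite-antitone
      }

  orientation : Orientation
  orientation with outer
  ... | f₀ , outer-cyc with face-surj f₀
  ...   | cyc k false , h = OuterOutgoing.orientation f₀ outer-cyc h
  ...   | cyc k true  , h = OuterArriving.orientation f₀ outer-cyc h
  ...   | gr j b      , h = ⊥-elim (outer-cyc (gr j b) h)

  open Orientation orientation

  _≟V_ : (u w : Vertex (suc n′) (m D)) → Dec (u ≡ w)
  corner  ≟V corner  = yes refl
  corner  ≟V bd _    = no λ ()
  corner  ≟V inner _ = no λ ()
  bd _    ≟V corner  = no λ ()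
  bd i    ≟V bd j with i ≟F j
  ... | yes refl = yes refl
  ... | no i≢j   = no λ { refl → i≢j refl }
  bd _    ≟V inner _ = no λ ()
  inner _ ≟V corner  = no λ ()
  inner _ ≟V bd _    = no λ ()
  inner i ≟V inner j with i ≟F j
  ... | yes refl = yes refl
  ... | no i≢j   = no λ { refl → i≢j refl }

  far : Fin N → Vertex (suc n′) (m D)
  far p = end D (edgeAt p) (not (sideAt p))

  farDart : Fin N → Darts
  farDart p = αD D (G p)

  αD-involutive : ∀ x → αD D (αD D x) ≡ x
  αD-involutive (cyc k b) = cong (cyc k) (not-involutive b)
  αD-involutive (gr j b)  = cong (gr j) (not-involutive b)

  farDart-injective : ∀ {p q} → farDart p ≡ farDart q → p ≡ q
  farDart-injective {p} {q} e =
    G-injective (trans (sym (αD-involutive (G p))) (trans (cong (αD D) e) (αD-involutive (G q))))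

  bd≢inner : ∀ {p v} {u : Vertex (suc n′) (m D)} → u ≡ bd p → u ≡ inner v → ⊥
  bd≢inner refl ()

  data FarView (p : Fin N) : Set where
    far-bd    : ∀ q → far p ≡ bd q → FarView p
    far-inner : ∀ v → far p ≡ inner v → FarView p

  farView : ∀ p → FarView p
  farView p with far p in eq
  ... | corner  = ⊥-elim (no-corner _ _ eq)
  ... | bd q    = far-bd q eq
  ... | inner v = far-inner v eq

  ¬inner-edge : ∀ j b {v w} → end D j b ≡ inner v → end D j (not b) ≡ inner w → ⊥
  ¬inner-edge j false e₁ e₂ = no-inner-edge j (subst IsInner (sym e₁) tt , subst IsInner (sym e₂) tt)
  ¬inner-edge j true  e₁ e₂ = no-inner-edge j (subst IsInner (sym e₂) tt , subst IsInner (sym e₁) tt)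

  cycV≢inner : ∀ {w v} → cycV {suc n′} {m D} w ≢ inner v
  cycV≢inner {zero}  ()
  cycV≢inner {suc _} ()

  -- Meaningful only for darts at inner vertices (see αD-leaf).
  leaf : Darts → Fin N
  leaf (cyc _ _) = zero
  leaf (gr j b) with end D j (not b)
  ... | bd q    = q
  ... | corner  = zero
  ... | inner _ = zero

  αD-leaf : ∀ d {v} → vert D d ≡ inner v → αD D d ≡ G (leaf d)
  αD-leaf (cyc k false) e = ⊥-elim (cycV≢inner e)
  αD-leaf (cyc k true)  e = ⊥-elim (cycV≢inner e)
  αD-leaf (gr j b)      e with end D j (not b) in e₂
  ... | bd q    = G-unique q j (not b) e₂
  ... | corner  = ⊥-elim (no-corner j (not b) e₂)
  ... | inner w = ⊥-elim (¬inner-edge j b e e₂)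

  farDart-leaf : ∀ d {v} → vert D d ≡ inner v → farDart (leaf d) ≡ d
  farDart-leaf d e = trans (cong (αD D) (sym (αD-leaf d e))) (αD-involutive d)

  farDart-G : ∀ {p q} → far p ≡ bd q → farDart q ≡ G p
  farDart-G {p} {q} e =
    trans (cong (αD D) (sym (G-unique q (edgeAt p) (not (sideAt p)) e))) (αD-involutive (G p))

  far-sym : ∀ {p q} → far p ≡ bd q → far q ≡ bd p
  far-sym {p} e = trans (cong (vert D) (farDart-G e)) (vert-G p)

  next : Fin N → Fin N
  next p with farView p
  ... | far-bd q _    = q
  ... | far-inner v _ = leaf (σ D (farDart p))

  prevLeaf : Fin N → Fin N
  prevLeaf p with farView p
  ... | far-bd q _    = q
  ... | far-inner v _ = leaf (σ⁻ D (farDart p))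

  next-bd : ∀ {p q} → far p ≡ bd q → next p ≡ q
  next-bd {p} e with farView p
  ... | far-bd q′ e′ with trans (sym e′) e
  ...   | refl = refl
  next-bd {p} e | far-inner v e′ = ⊥-elim (bd≢inner e e′)

  farDart-next : ∀ {p v} → far p ≡ inner v → farDart (next p) ≡ σ D (farDart p)
  farDart-next {p} e with farView p
  ... | far-bd q e′    = ⊥-elim (bd≢inner e′ e)
  ... | far-inner w e′ = farDart-leaf (σ D (farDart p)) (trans (σ-vert _) e′)

  far-next : ∀ {p v} → far p ≡ inner v → far (next p) ≡ inner v
  far-next {p} e = trans (cong (vert D) (farDart-next e)) (trans (σ-vert (farDart p)) e)

  next-prevLeaf : ∀ p → next (prevLeaf p) ≡ p
  next-prevLeaf p with farView p
  ... | far-bd q e    = next-bd (far-sym e)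
  ... | far-inner v e = farDart-injective
          (trans (farDart-next far-q) (trans (cong (σ D) (farDart-leaf d vd)) (σσ⁻ (farDart p))))
    where
    d : Darts
    d = σ⁻ D (farDart p)
    vd : vert D d ≡ inner v
    vd = trans (sym (σ-vert d)) (trans (cong (vert D) (σσ⁻ (farDart p))) e)
    far-q : far (leaf d) ≡ inner v
    far-q = trans (cong (vert D) (farDart-leaf d vd)) vd

  -- Since b has no inner edges, a component of b is either an edge joining two
  -- boundary points or the star of an inner vertex.
  _∼_ : Fin N → Fin N → Set
  p ∼ q = p ≡ q ⊎ far p ≡ bd q ⊎ ∃[ v ] far p ≡ inner v × far q ≡ inner v

  ∼-isEquivalence : IsEquivalence _∼_
  ∼-isEquivalence = record { refl = inj₁ refl ; sym = ∼-sym ; trans = ∼-trans }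
    where
    ∼-sym : ∀ {p q} → p ∼ q → q ∼ p
    ∼-sym (inj₁ refl)                 = inj₁ refl
    ∼-sym (inj₂ (inj₁ e))             = inj₂ (inj₁ (far-sym e))
    ∼-sym (inj₂ (inj₂ (v , e₁ , e₂))) = inj₂ (inj₂ (v , e₂ , e₁))
    ∼-trans : ∀ {p q s} → p ∼ q → q ∼ s → p ∼ s
    ∼-trans (inj₁ refl) qs = qs
    ∼-trans pq (inj₁ refl) = pq
    ∼-trans (inj₂ (inj₁ e)) (inj₂ (inj₁ e′)) with trans (sym (far-sym e)) e′
    ... | refl = inj₁ refl
    ∼-trans (inj₂ (inj₁ e)) (inj₂ (inj₂ (_ , e₁ , _))) = ⊥-elim (bd≢inner (far-sym e) e₁)
    ∼-trans (inj₂ (inj₂ (_ , _ , e₂))) (inj₂ (inj₁ e′)) = ⊥-elim (bd≢inner e′ e₂)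
    ∼-trans (inj₂ (inj₂ (v , e₁ , e₂))) (inj₂ (inj₂ (w , e₃ , e₄))) with trans (sym e₂) e₃
    ... | refl = inj₂ (inj₂ (v , e₁ , e₄))

  open IsEquivalence ∼-isEquivalence using () renaming (refl to ∼-refl; sym to ∼-sym; trans to ∼-trans)

  ∼-next : ∀ p → p ∼ next p
  ∼-next p = from-view (farView p)
    where
    from-view : FarView p → p ∼ next p
    from-view (far-bd q e)    = inj₂ (inj₁ (trans e (cong bd (sym (next-bd e)))))
    from-view (far-inner v e) = inj₂ (inj₂ (v , e , far-next e))

  farDart-iter-next : ∀ {p v} → far p ≡ inner v →
                      ∀ k → farDart (iter next k p) ≡ iter (σ D) k (farDart p)
  farDart-iter-next e zero    = refl
  farDart-iter-next {p} {v} e (suc k) =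
    trans (farDart-next (iter-far k)) (cong (σ D) (farDart-iter-next e k))
    where
    iter-far : ∀ k → far (iter next k p) ≡ inner v
    iter-far zero    = e
    iter-far (suc k) = far-next (iter-far k)

  ∼⇒next-reachable : ∀ {p q} → p ∼ q → ∃[ i ] iter next i p ≡ q
  ∼⇒next-reachable (inj₁ refl)     = 0 , refl
  ∼⇒next-reachable (inj₂ (inj₁ e)) = 1 , next-bd e
  ∼⇒next-reachable {p} {q} (inj₂ (inj₂ (v , e₁ , e₂)))
    with σ-orbit (farDart p) (farDart q) (trans e₁ (sym e₂))
  ... | k , ek = k , farDart-injective (trans (farDart-iter-next e₁ k) ek)

  _∼?_ : Decidable₂ _∼_
  p ∼? q with p ≟F q | far p ≟V bd q | farView p
  ... | yes p≡q | _        | _             = yes (inj₁ p≡q)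
  ... | no _    | yes e    | _             = yes (inj₂ (inj₁ e))
  ... | no p≢q  | no ¬e    | far-bd r e′   = no λ
    { (inj₁ x) → p≢q x ; (inj₂ (inj₁ x)) → ¬e x ; (inj₂ (inj₂ (_ , x , _))) → bd≢inner e′ x }
  ... | no p≢q  | no ¬e    | far-inner v e′ with far q ≟V inner v
  ...   | yes e″ = yes (inj₂ (inj₂ (v , e′ , e″)))
  ...   | no ¬e″ = no λ
    { (inj₁ x) → p≢q x ; (inj₂ (inj₁ x)) → ¬e x
    ; (inj₂ (inj₂ (w , x , y))) → ¬e″ (trans y (trans (sym x) e′)) }

  path-to-far : ∀ p → Path D (bd p) (far p)
  path-to-far p = step (edgeAt p) (sideAt p) (subst (Path D (bd p)) (sym (vert-G p)) here)

  ∼⇒αPart : ∀ {p q} → p ∼ q → αPart D p q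
  ∼⇒αPart (inj₁ refl)         = here
  ∼⇒αPart {p} (inj₂ (inj₁ e)) = subst (Path D (bd p)) e (path-to-far p)
  ∼⇒αPart {p} {q} (inj₂ (inj₂ (v , e₁ , e₂))) =
    subst (Path D (bd p)) (trans (cong (end D (edgeAt q)) (not-involutive (sideAt q))) (vert-G q))
      (step (edgeAt q) (not (sideAt q)) (subst (Path D (bd p)) (trans e₁ (sym e₂)) (path-to-far p)))

  InComponent : Fin N → Vertex (suc n′) (m D) → Set
  InComponent p corner    = ⊥
  InComponent p (bd q)    = p ∼ q
  InComponent p (inner v) = far p ≡ inner v

  InComponent-far : ∀ {p q} → p ∼ q → InComponent p (far q)
  InComponent-far {p} {q} pq with farView q
  ... | far-bd s e    = subst (InComponent p) (sym e) (∼-trans pq (inj₂ (inj₁ e)))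
  ... | far-inner v e = subst (InComponent p) (sym e) (shares pq)
    where
    shares : p ∼ q → far p ≡ inner v
    shares (inj₁ refl)                 = e
    shares (inj₂ (inj₁ e′))            = ⊥-elim (bd≢inner (far-sym e′) e)
    shares (inj₂ (inj₂ (w , e₁ , e₂))) = trans e₁ (trans (sym e₂) e)

  InComponent-step : ∀ p j b → InComponent p (end D j b) → InComponent p (end D j (not b))
  InComponent-step p j b c with end D j b in e₁
  ... | corner = ⊥-elim c
  ... | bd q with G-unique q j b e₁
  ...   | refl = InComponent-far c
  InComponent-step p j b c | inner v with end D j (not b) in e₂
  ...   | corner  = ⊥-elim (no-corner j (not b) e₂)
  ...   | inner w = ⊥-elim (¬inner-edge j b e₁ e₂)
  ...   | bd s    = inj₂ (inj₂ (v , c , far-s))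
    where
    far-s : far s ≡ inner v
    far-s = trans (cong (vert D ∘ αD D) (sym (G-unique s j (not b) e₂)))
                  (trans (cong (end D j) (not-involutive b)) e₁)

  αPart⇒∼ : ∀ {p q} → αPart D p q → p ∼ q
  αPart⇒∼ {p} = reach
    where
    reach : ∀ {w} → Path D (bd p) w → InComponent p w
    reach here            = ∼-refl
    reach (step j b path) = InComponent-step p j b (reach path)

  σ-no-fixed-point-inner : ∀ {x v} → vert D x ≡ inner v → σ D x ≢ x
  σ-no-fixed-point-inner {x} {v} vx fixed with inner-val3 v
  ... | d₁ , d₂ , _ , v₁ , v₂ , _ , d₁≢d₂ , _ =
    d₁≢d₂ (trans (sym (σ-fixed⇒alone fixed d₁ (trans vx (sym v₁))))
                 (σ-fixed⇒alone fixed d₂ (trans vx (sym v₂))))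

  next≢ : ∀ p → next p ≢ p
  next≢ p = from-view (farView p)
    where
    side-injective : ∀ {j b b′} → _≡_ {A = Darts} (gr j b) (gr j b′) → b ≡ b′
    side-injective refl = refl
    from-view : FarView p → next p ≢ p
    from-view (far-bd q e) eq =
      not-¬ refl (sym (side-injective (G-unique p _ _ (trans e (cong bd (trans (sym (next-bd e)) eq))))))
    from-view (far-inner v e) eq =
      σ-no-fixed-point-inner e (trans (sym (farDart-next e)) (cong farDart eq))

  no-singletons : NoSingletons (αPart D)
  no-singletons p = next p , next≢ p , ∼⇒αPart (∼-next p)

  τ : Fin N → Fin N
  τ p = down (next p)

  faceG : Fin N → Fin (F D)
  faceG p = face D (G p)

  inner-not-G : ∀ {x v} → vert D x ≡ inner v → ∀ q → x ≢ G q
  inner-not-G vx q refl = bd≢inner (vert-G q) vx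

  walk-φG : ∀ p → FaceWalk (φ D (G p)) (τ p)
  walk-φG p = from-view (farView p)
    where
    from-view : FarView p → FaceWalk (φ D (G p)) (τ p)
    from-view (far-bd q e) =
      subst₂ FaceWalk (cong (σ D) (sym (farDart-G (far-sym e)))) (cong down (sym (next-bd e))) (walk-σG q)
    from-view (far-inner v e) =
      subst (λ z → FaceWalk z (τ p)) (farDart-next e)
        (pass (inner-not-G (far-next e))
          (subst (λ z → FaceWalk z (τ p)) (cong (σ D) (sym (αD-involutive (G (next p)))))
            (walk-σG (next p))))

  face-τ : ∀ p → faceG (τ p) ≡ faceG p
  face-τ p = sym (trans (sym (face-φ (G p))) (face-walk (walk-φG p)))

  walk-reach : ∀ k {x t q} → FaceWalk x t → iter (φ D) k x ≡ G q → ∃[ i ] iter τ i t ≡ q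
  walk-reach zero    (arrive t)  e = 0 , G-injective e
  walk-reach (suc k) (arrive t)  e with walk-reach k (walk-φG t) (trans (iter-shift (φ D) k (G t)) e)
  ... | i , ei = suc i , trans (sym (iter-shift τ i t)) ei
  walk-reach zero    (pass ¬G w) e = ⊥-elim (¬G _ e)
  walk-reach (suc k) {x} (pass ¬G w) e = walk-reach k w (trans (iter-shift (φ D) k x) e)

  face⇒τ-reachable : ∀ {p q} → faceG p ≡ faceG q → ∃[ i ] iter τ i p ≡ q
  face⇒τ-reachable {p} {q} e with face-orbit (G p) (G q) e
  ... | k , ek = walk-reach k (arrive p) ek

  walk-exists : ∀ x → face D x ≢ outerFace → ∃ (FaceWalk x)
  walk-exists (cyc k b) ¬outer with cyc-outer-or-walk (cyc k b) tt
  ... | inj₁ outer = ⊥-elim (¬outer outer)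
  ... | inj₂ walk  = walk
  walk-exists (gr j b) _ with end D j b in e
  ... | bd p    = p , subst (λ z → FaceWalk z p) (sym (G-unique p j b e)) (arrive p)
  ... | corner  = ⊥-elim (no-corner j b e)
  ... | inner v = down (leaf (gr j b)) , pass (inner-not-G e)
                    (subst (λ z → FaceWalk z (down (leaf (gr j b)))) (cong (σ D) (sym (αD-leaf (gr j b) e)))
                      (walk-σG (leaf (gr j b))))

  open RankedBlocksAndFaces rank rank-injective ∼-isEquivalence _∼?_ next ∼-next ∼⇒next-reachable
         τ (rank-down ∘ next) faceG face-τ face⇒τ-reachable

  -- Tightness, from Euler's formula

  inner-vertices+faces : m D + F D ≡ 2 + e D
  inner-vertices+faces = +-cancelˡ-≡ (suc N) _ _ (begin
    suc N + (m D + F D)   ≡⟨ +-assoc (suc N) (m D) (F D) ⟨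
    (suc N + m D) + F D   ≡⟨ euler ⟩
    (suc N + e D) + 2     ≡⟨ +-assoc (suc N) (e D) 2 ⟩
    suc N + (e D + 2)     ≡⟨ cong (suc N +_) (+-comm (e D) 2) ⟩
    suc N + (2 + e D)     ∎)
    where open ≡-Reasoning

  same-edge : ∀ {p q} → edgeAt p ≡ edgeAt q → p ≡ q ⊎ far p ≡ bd q
  same-edge {p} {q} e with sideAt p ≟B sideAt q
  ... | yes s = inj₁ (G-injective (cong₂ gr e s))
  ... | no ¬s = inj₂ (trans (cong₂ (end D) e (sym (¬-not (¬s ∘ sym)))) (vert-G q))

  rank<partner : ∀ {p q} → far p ≡ bd q → NotTop p → rank p < rank q
  rank<partner e (_ , inj₁ refl , lt) = ⊥-elim (<-irrefl refl lt)
  rank<partner e (_ , inj₂ (inj₁ e′) , lt) with trans (sym e) e′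
  ... | refl = lt
  rank<partner e (_ , inj₂ (inj₂ (_ , e′ , _)) , _) = ⊥-elim (bd≢inner e e′)

  same-edge-leaves : ∀ {p q} → (∃[ v ] far p ≡ inner v) ⊎ NotTop p →
                     (∃[ v ] far q ≡ inner v) ⊎ NotTop q → edgeAt p ≡ edgeAt q → p ≡ q
  same-edge-leaves hp hq e with same-edge e | hp | hq
  ... | inj₁ p≡q | _                  | _                  = p≡q
  ... | inj₂ pq  | inj₁ (_ , inner-p) | _                  = ⊥-elim (bd≢inner pq inner-p)
  ... | inj₂ pq  | inj₂ _             | inj₁ (_ , inner-q) = ⊥-elim (bd≢inner (far-sym pq) inner-q)
  ... | inj₂ pq  | inj₂ ntp           | inj₂ ntq           =
    ⊥-elim (<-asym (rank<partner pq ntp) (rank<partner (far-sym pq) ntq))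

  leaf-at : ∀ v → ∃[ q ] far q ≡ inner v
  leaf-at v with inner-val3 v
  ... | d , _ , _ , vd , _ = leaf d , trans (cong (vert D) (farDart-leaf d vd)) vd

  topLeaf : Fin (m D) → Fin N
  topLeaf v = proj₁ (argmax (λ q → far q ≟V inner v) rank (leaf-at v))

  far-topLeaf : ∀ v → far (topLeaf v) ≡ inner v
  far-topLeaf v = proj₁ (proj₂ (argmax (λ q → far q ≟V inner v) rank (leaf-at v)))

  topLeaf-top : ∀ v → ¬ NotTop (topLeaf v)
  topLeaf-top v (q , inj₁ refl , lt)                 = <-irrefl refl lt
  topLeaf-top v (q , inj₂ (inj₁ e) , _)              = bd≢inner e (far-topLeaf v)
  topLeaf-top v (q , inj₂ (inj₂ (w , e₁ , e₂)) , lt) =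
    <⇒≱ lt (proj₂ (proj₂ (argmax (λ q → far q ≟V inner v) rank (leaf-at v)))
              q (trans e₂ (trans (sym e₁) (far-topLeaf v))))

  face-has-G : ∀ f → f ≢ outerFace → ∃[ p ] faceG p ≡ f
  face-has-G f f≢o with face-surj f
  ... | x , fx with walk-exists x (λ o → f≢o (trans (sym fx) o))
  ...   | t , w = t , trans (sym (face-walk w)) fx

  -- Charge each inner vertex to the edge of its top leaf, the outer face to an
  -- extra token, and each inner face f with top boundary point M to the edge of the
  -- leaf k with rank (next k) = rank M + 1 (then τ k = M, so k lies in f).  If M is
  -- the last boundary point, f is charged to an untight leaf k★ instead; untightness
  -- keeps k★ from being charged twice.  The charges are distinct, so m + F ≤ e + 1.
  module Charging {k★ q★ : Fin N} (k★-notTop : NotTop k★) (q★-face : faceG q★ ≡ faceG k★)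
                  (q★-high : rank (next k★) ≤ rank q★) where

    IsTopOf : Fin (F D) → Fin N → Set
    IsTopOf f M = faceG M ≡ f × (∀ q → faceG q ≡ f → rank q ≤ rank M)

    data FaceLeaf (f : Fin (F D)) (k : Fin N) : Set where
      after-top : ∀ {M} → IsTopOf f M → faceG k ≡ f → rank (next k) ≡ suc (rank M) → FaceLeaf f k
      untight   : ∀ {M} → IsTopOf f M → k ≡ k★ → suc (rank M) ≡ N → FaceLeaf f k

    k★-not-after-top : ∀ {f M} → IsTopOf f M → faceG k★ ≡ f → rank (next k★) ≡ suc (rank M) → ⊥
    k★-not-after-top (_ , maxM) fk nk =
      1+n≰n (≤-trans (subst (_≤ rank q★) nk q★-high) (maxM q★ (trans q★-face fk)))

    FaceLeaf-functional : ∀ {f f′ k} → FaceLeaf f k → FaceLeaf f′ k → f ≡ f′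
    FaceLeaf-functional (after-top _ fk _) (after-top _ fk′ _) = trans (sym fk) fk′
    FaceLeaf-functional (after-top tM fk nk) (untight _ refl _) = ⊥-elim (k★-not-after-top tM fk nk)
    FaceLeaf-functional (untight _ refl _) (after-top tM fk nk) = ⊥-elim (k★-not-after-top tM fk nk)
    FaceLeaf-functional (untight (fM , _) _ eM) (untight (fM′ , _) _ eM′) =
      trans (sym fM) (trans (cong faceG (rank-injective (suc-injective (trans eM (sym eM′))))) fM′)

    faceLeaf : ∀ f → f ≢ outerFace → ∃[ k ] NotTop k × FaceLeaf f k
    faceLeaf f f≢o with argmax (λ q → faceG q ≟F f) rank (face-has-G f f≢o)
    ... | M , fM , maxM with suc (rank M) <? N
    ...   | no ¬lt = k★ , k★-notTop , untight (fM , maxM) refl (≤-antisym (rank<N M) (≮⇒≥ ¬lt))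
    ...   | yes lt with up M lt
    ...     | q , down-q , rank-q = prevLeaf q , notTop , after-top (fM , maxM) fk rank-nk
      where
      rank-nk : rank (next (prevLeaf q)) ≡ suc (rank M)
      rank-nk = trans (cong rank (next-prevLeaf q)) rank-q
      fk : faceG (prevLeaf q) ≡ f
      fk = trans (sym (face-τ (prevLeaf q)))
                 (trans (cong (faceG ∘ down) (next-prevLeaf q)) (trans (cong faceG down-q) fM))
      notTop : NotTop (prevLeaf q)
      notTop = next (prevLeaf q) , ∼-next (prevLeaf q) ,
               ≤-<-trans (maxM _ fk) (subst (rank M <_) (sym rank-nk) (n<1+n _))

    data Charge : Fin (m D) ⊎ Fin (F D) → Fin (suc (e D)) → Set where
      vertex    : ∀ v → Charge (inj₁ v) (suc (edgeAt (topLeaf v)))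
      outside   : Charge (inj₂ outerFace) zero
      innerFace : ∀ {f k} → NotTop k → FaceLeaf f k → Charge (inj₂ f) (suc (edgeAt k))

    charge : ∀ a → ∃ (Charge a)
    charge (inj₁ v) = _ , vertex v
    charge (inj₂ f) with f ≟F outerFace
    ... | yes refl = _ , outside
    ... | no f≢o with faceLeaf f f≢o
    ...   | _ , nt , fl = _ , innerFace nt fl

    charge-injective : ∀ {a b x y} → Charge a x → Charge b y → x ≡ y → a ≡ b
    charge-injective outside       outside       _ = refl
    charge-injective outside       (vertex _)    ()
    charge-injective outside       (innerFace _ _) ()
    charge-injective (vertex _)    outside       ()
    charge-injective (innerFace _ _) outside     ()
    charge-injective (vertex v) (vertex w) e
      with same-edge-leaves (inj₁ (_ , far-topLeaf v)) (inj₁ (_ , far-topLeaf w)) (Fin.suc-injective e)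
    ... | t with trans (sym (far-topLeaf v)) (trans (cong far t) (far-topLeaf w))
    ...   | refl = refl
    charge-injective (vertex v) (innerFace nt _) e =
      ⊥-elim (topLeaf-top v (subst NotTop
        (sym (same-edge-leaves (inj₁ (_ , far-topLeaf v)) (inj₂ nt) (Fin.suc-injective e))) nt))
    charge-injective (innerFace nt _) (vertex v) e =
      ⊥-elim (topLeaf-top v (subst NotTop
        (same-edge-leaves (inj₂ nt) (inj₁ (_ , far-topLeaf v)) (Fin.suc-injective e)) nt))
    charge-injective (innerFace nt fl) (innerFace nt′ fl′) e
      with same-edge-leaves (inj₂ nt) (inj₂ nt′) (Fin.suc-injective e)
    ... | refl = cong inj₂ (FaceLeaf-functional fl fl′)

    charges-bound : m D + F D ≤ suc (e D)
    charges-bound = injective⇒≤ injective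
      where
      chargeOf : Fin (m D + F D) → Fin (suc (e D))
      chargeOf i = proj₁ (charge (splitAt (m D) i))
      injective : ∀ {i j} → chargeOf i ≡ chargeOf j → i ≡ j
      injective {i} {j} e = splitAt-injective (m D)
        (charge-injective (proj₂ (charge (splitAt (m D) i))) (proj₂ (charge (splitAt (m D) j))) e)

  tight : Tight
  tight k q nt fq = ≰⇒> λ le →
    1+n≰n (subst (_≤ suc (e D)) inner-vertices+faces (Charging.charges-bound nt fq le))

  noncrossing : NonCrossing (αPart D)
  noncrossing = NoLinearCrossing⇒NonCrossing
    (λ r → ∼⇒αPart (∼-sym (αPart⇒∼ r)))
    (λ r s → ∼⇒αPart (∼-trans (αPart⇒∼ r) (αPart⇒∼ s)))
    linear
    where
    linear : NoLinearCrossing toℕ (αPart D)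
    linear a₁ a₂ b₁ b₂ ra rb ¬ab =
      NoLinearCrossing-reindex ∼-sym ∼-trans toℕ rank rank-monotone (noLinearCrossing tight)
        a₁ a₂ b₁ b₂ (αPart⇒∼ ra) (αPart⇒∼ rb) (λ r → ¬ab (∼⇒αPart r))

mainTheorem4 : (n : ℕ) (D : RawDiagram n) → InB D → InP (αPart D)
mainTheorem4 zero    D ib = (λ ()) , (λ ())
mainTheorem4 (suc n) D ib = Diagram.noncrossing D ib , Diagram.no-singletons D ib
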